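{- Let $d\in\mathbb N\cup\{\infty\}$ and let $w\in\mathbb Z^{V_d}$ be an outcome with $\mathrm{supp}^-(w)=\emptyset$. Then $w$ is the zero configuration.
   Context: $V_d=\{(i,j)\in\mathbb Z_{\geq0}^2\mid i+j\leq d\}$. A chip configuration is a finitely supported $w\in\mathbb Z^{V_d}$. A splitting move at $p\in V_{d-1}$ decreases $w_p$ by $1$ and increases $w_{p+(1,0)}$, $w_{p+(0,1)}$ by $1$; an unsplitting move is its inverse; an outcome is a configuration reachable from the zero configuration by finitely many moves. $\mathrm{supp}^-(w)=\{(i,j)\mid w_{i,j}<0\}$. -}

module Defs where

open import Data.Nat using (ℕ; suc; _+_; _≤_; _≟_)
open import Data.Integer using (ℤ; 0ℤ; 1ℤ) renaming (_+_ to _+ℤ_; _-_ to _-ℤ_)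
open import Data.Bool using (if_then_else_; _∧_)
open import Data.List using (List; foldr)
open import Data.Unit using (⊤)
open import Relation.Nullary.Decidable using (⌊_⌋)

data ℕ∞ : Set where
  fin : ℕ → ℕ∞
  ∞   : ℕ∞

InV : ℕ∞ → ℕ → ℕ → Set
InV (fin d) i j = i + j ≤ d
InV ∞       i j = ⊤

-- (i , j) ∈ V_{d-1}  ⇔  i + j + 1 ≤ d   (V_{-1} = ∅, V_{∞-1} = V_∞)
InVpred : ℕ∞ → ℕ → ℕ → Set
InVpred (fin d) i j = suc (i + j) ≤ d
InVpred ∞       i j = ⊤

-- chip configurations, as functions on ℤ≥0² (moves only ever touch V_d)
Config : Set
Config = ℕ → ℕ → ℤ

zeroConfig : Config
zeroConfig _ _ = 0ℤ

δ : ℕ → ℕ → Config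
δ i j a b = if ⌊ a ≟ i ⌋ ∧ ⌊ b ≟ j ⌋ then 1ℤ else 0ℤ

split : ℕ → ℕ → Config → Config
split i j w a b = ((w a b -ℤ δ i j a b) +ℤ δ (suc i) j a b) +ℤ δ i (suc j) a b

unsplit : ℕ → ℕ → Config → Config
unsplit i j w a b = ((w a b +ℤ δ i j a b) -ℤ δ (suc i) j a b) -ℤ δ i (suc j) a b

data Kind : Set where
  splitK unsplitK : Kind

record Move : Set where
  constructor move
  field
    kind : Kind
    pi   : ℕ
    pj   : ℕ

open Move public

applyMove : Move → Config → Config
applyMove (move splitK i j)   = split i j
applyMove (move unsplitK i j) = unsplit i j

-- result of applying a finite sequence of moves (head applied last) to the zero configuration
run : List Move → Config
run = foldr applyMove zeroConfig

LegalMove : ℕ∞ → Move → Set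
LegalMove d m = InVpred d (pi m) (pj m)

{-# OPTIONS --safe #-}
-- Give a chip at (a , b) the weight 2 ^ (N ∸ (a + b)).  A move at p ∈ V_{N-1} trades one chip
-- of weight 2 ^ (k + 1) at p for chips of weight 2 ^ k at p + (1 , 0) and p + (0 , 1), so the
-- weighted sum over V_N is invariant and hence 0 on every outcome.  A sum of nonnegative terms
-- with positive weights vanishes only if every term does.  For d = ∞ take N large enough to
-- contain all the moves and the point at hand.
module Submission where

open import Defs
open import Data.Nat using (ℕ)
open import Data.Integer using (0ℤ; _≤_)
open import Data.List using (List)
open import Data.List.Relation.Unary.All using (All)
open import Relation.Binary.PropositionalEquality using (_≡_)

import Data.Nat as ℕ
open import Data.Nat using (zero; suc; z≤n; s≤s; _∸_; _^_; _⊔_)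
import Data.Nat.Properties as ℕ
open import Data.Integer using (ℤ; 1ℤ; +_; +≤+; _+_; _-_; -_; _*_)
open import Data.Integer.Properties
open import Data.Integer.Tactic.RingSolver using (solve-∀)
open import Algebra.Properties.CommutativeSemigroup +-commutativeSemigroup using (interchange)
open import Data.List using ([]; _∷_)
open import Data.List.Relation.Unary.All using ([]; _∷_)
open import Data.Product using (_×_; _,_)
open import Data.Unit using (tt)
open import Relation.Nullary using (yes; no; ¬_; contradiction)
open import Relation.Binary.PropositionalEquality
  using (refl; sym; trans; cong; cong₂; subst; module ≡-Reasoning)

open ≡-Reasoning

∑≤ : ℕ → (ℕ → ℤ) → ℤ
∑≤ zero    f = f 0
∑≤ (suc M) f = ∑≤ M f + f (suc M)

restrict : ∀ {M} {P : ℕ → Set} → (∀ x → x ℕ.≤ suc M → P x) → ∀ x → x ℕ.≤ M → P x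
restrict h x x≤M = h x (ℕ.m≤n⇒m≤1+n x≤M)

∑≤-cong : ∀ M {f g : ℕ → ℤ} → (∀ x → x ℕ.≤ M → f x ≡ g x) → ∑≤ M f ≡ ∑≤ M g
∑≤-cong zero    f≗g = f≗g 0 z≤n
∑≤-cong (suc M) f≗g =
  cong₂ _+_ (∑≤-cong M (restrict f≗g)) (f≗g (suc M) ℕ.≤-refl)

∑≤-distrib-+ : ∀ M (f g : ℕ → ℤ) → ∑≤ M (λ x → f x + g x) ≡ ∑≤ M f + ∑≤ M g
∑≤-distrib-+ zero    f g = refl
∑≤-distrib-+ (suc M) f g = trans
  (cong (_+ (f (suc M) + g (suc M))) (∑≤-distrib-+ M f g))
  (interchange (∑≤ M f) (∑≤ M g) (f (suc M)) (g (suc M)))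

∑≤-neg : ∀ M (f : ℕ → ℤ) → ∑≤ M (λ x → - f x) ≡ - ∑≤ M f
∑≤-neg zero    f = refl
∑≤-neg (suc M) f = trans
  (cong (_+ (- f (suc M))) (∑≤-neg M f))
  (sym (neg-distrib-+ (∑≤ M f) (f (suc M))))

∑≤-zero : ∀ M {f : ℕ → ℤ} → (∀ x → x ℕ.≤ M → f x ≡ 0ℤ) → ∑≤ M f ≡ 0ℤ
∑≤-zero zero    f≡0 = f≡0 0 z≤n
∑≤-zero (suc M) f≡0 =
  cong₂ _+_ (∑≤-zero M (restrict f≡0)) (f≡0 (suc M) ℕ.≤-refl)

∑≤-point : ∀ M {f : ℕ → ℤ} {x} → x ℕ.≤ M → (∀ y → ¬ y ≡ x → f y ≡ 0ℤ) → ∑≤ M f ≡ f x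
∑≤-point zero    z≤n _ = refl
∑≤-point (suc M) {f} {x} x≤1+M f≡0 with x ℕ.≟ suc M
... | yes refl = trans
  (cong (_+ f (suc M)) (∑≤-zero M (λ y y≤M → f≡0 y (λ { refl → ℕ.1+n≰n y≤M }))))
  (+-identityˡ (f (suc M)))
... | no x≢1+M = trans
  (cong₂ _+_ (∑≤-point M (ℕ.≤-pred (ℕ.≤∧≢⇒< x≤1+M x≢1+M)) f≡0) (f≡0 (suc M) (λ { refl → x≢1+M refl })))
  (+-identityʳ (f x))

∑≤-nonneg : ∀ M {f : ℕ → ℤ} → (∀ x → x ℕ.≤ M → 0ℤ ≤ f x) → 0ℤ ≤ ∑≤ M f
∑≤-nonneg zero    f≥0 = f≥0 0 z≤n
∑≤-nonneg (suc M) f≥0 =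
  +-mono-≤ (∑≤-nonneg M (restrict f≥0)) (f≥0 (suc M) ℕ.≤-refl)

+-nonneg-≡0 : ∀ {i j} → 0ℤ ≤ i → 0ℤ ≤ j → i + j ≡ 0ℤ → i ≡ 0ℤ × j ≡ 0ℤ
+-nonneg-≡0 {+ zero}  {+ zero}  _ _ _ = refl , refl
+-nonneg-≡0 {+ zero}  {+ suc n} _ _ ()
+-nonneg-≡0 {+ suc m} {+ n}     _ _ ()

∑≤-nonneg-≡0 : ∀ M {f : ℕ → ℤ} → (∀ x → x ℕ.≤ M → 0ℤ ≤ f x) → ∑≤ M f ≡ 0ℤ →
               ∀ x → x ℕ.≤ M → f x ≡ 0ℤ
∑≤-nonneg-≡0 zero    _   ∑≡0 zero z≤n = ∑≡0
∑≤-nonneg-≡0 (suc M) f≥0 ∑≡0 x x≤1+M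
  with +-nonneg-≡0 (∑≤-nonneg M (restrict f≥0)) (f≥0 (suc M) ℕ.≤-refl) ∑≡0
     | x ℕ.≟ suc M
... | _ , last≡0 | yes refl = last≡0
... | init≡0 , _ | no x≢1+M =
  ∑≤-nonneg-≡0 M (restrict f≥0) init≡0 x (ℕ.≤-pred (ℕ.≤∧≢⇒< x≤1+M x≢1+M))

∑△ : ℕ → (ℕ → ℕ → ℤ) → ℤ
∑△ N f = ∑≤ N (λ a → ∑≤ (N ∸ a) (f a))

module _ {N a b : ℕ} (a+b≤N : a ℕ.+ b ℕ.≤ N) where

  row≤ : a ℕ.≤ N
  row≤ = ℕ.m+n≤o⇒m≤o a a+b≤N

  column≤ : b ℕ.≤ N ∸ a
  column≤ = ℕ.m+n≤o⇒m≤o∸n b (subst (ℕ._≤ N) (ℕ.+-comm a b) a+b≤N)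

in-triangle : ∀ {N a b} → a ℕ.≤ N → b ℕ.≤ N ∸ a → a ℕ.+ b ℕ.≤ N
in-triangle {N} {a} {b} a≤N b≤N∸a = subst (ℕ._≤ N) (ℕ.+-comm b a) (ℕ.m≤o∸n⇒m+n≤o b a≤N b≤N∸a)

∑△-cong : ∀ N {f g : ℕ → ℕ → ℤ} → (∀ a b → f a b ≡ g a b) → ∑△ N f ≡ ∑△ N g
∑△-cong N f≗g = ∑≤-cong N (λ a _ → ∑≤-cong (N ∸ a) (λ b _ → f≗g a b))

∑△-distrib-+ : ∀ N (f g : ℕ → ℕ → ℤ) → ∑△ N (λ a b → f a b + g a b) ≡ ∑△ N f + ∑△ N g
∑△-distrib-+ N f g = trans
  (∑≤-cong N (λ a _ → ∑≤-distrib-+ (N ∸ a) (f a) (g a)))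
  (∑≤-distrib-+ N _ _)

∑△-neg : ∀ N (f : ℕ → ℕ → ℤ) → ∑△ N (λ a b → - f a b) ≡ - ∑△ N f
∑△-neg N f = trans (∑≤-cong N (λ a _ → ∑≤-neg (N ∸ a) (f a))) (∑≤-neg N _)

∑△-zero : ∀ N {f : ℕ → ℕ → ℤ} → (∀ a b → f a b ≡ 0ℤ) → ∑△ N f ≡ 0ℤ
∑△-zero N f≡0 = ∑≤-zero N (λ a _ → ∑≤-zero (N ∸ a) (λ b _ → f≡0 a b))

∑△-nonneg-≡0 : ∀ N {f : ℕ → ℕ → ℤ} → (∀ a b → a ℕ.+ b ℕ.≤ N → 0ℤ ≤ f a b) → ∑△ N f ≡ 0ℤ →
               ∀ a b → a ℕ.+ b ℕ.≤ N → f a b ≡ 0ℤ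
∑△-nonneg-≡0 N {f} f≥0 ∑≡0 a b a+b≤N =
  ∑≤-nonneg-≡0 (N ∸ a) (row≥0 (row≤ a+b≤N)) row≡0 b (column≤ a+b≤N)
  where
  row≥0 : ∀ {a} → a ℕ.≤ N → ∀ b → b ℕ.≤ N ∸ a → 0ℤ ≤ f a b
  row≥0 a≤N b b≤N∸a = f≥0 _ b (in-triangle a≤N b≤N∸a)
  row≡0 : ∑≤ (N ∸ a) (f a) ≡ 0ℤ
  row≡0 = ∑≤-nonneg-≡0 N (λ a a≤N → ∑≤-nonneg (N ∸ a) (row≥0 a≤N)) ∑≡0 a (row≤ a+b≤N)

δ-off-row : ∀ {i j a} b → ¬ a ≡ i → δ i j a b ≡ 0ℤ
δ-off-row {i} {a = a} _ a≢i with a ℕ.≟ i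
... | yes a≡i = contradiction a≡i a≢i
... | no _    = refl

δ-off-column : ∀ {i j b} → ¬ b ≡ j → δ i j i b ≡ 0ℤ
δ-off-column {i} {j} {b} b≢j with i ℕ.≟ i | b ℕ.≟ j
... | _     | yes b≡j = contradiction b≡j b≢j
... | yes _ | no _    = refl
... | no _  | no _    = refl

δ-diagonal : ∀ i j → δ i j i j ≡ 1ℤ
δ-diagonal i j with i ℕ.≟ i | j ℕ.≟ j
... | yes _ | yes _ = refl
... | no i≢i | _    = contradiction refl i≢i
... | yes _ | no j≢j = contradiction refl j≢j

∑△-*δ : ∀ N {i j} (g : ℕ → ℕ → ℤ) → i ℕ.+ j ℕ.≤ N → ∑△ N (λ a b → g a b * δ i j a b) ≡ g i j
∑△-*δ N {i} {j} g i+j≤N = begin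
  ∑△ N (λ a b → g a b * δ i j a b)     ≡⟨ ∑≤-point N (row≤ i+j≤N) off-row ⟩
  ∑≤ (N ∸ i) (λ b → g i b * δ i j i b) ≡⟨ ∑≤-point (N ∸ i) (column≤ i+j≤N) off-column ⟩
  g i j * δ i j i j                    ≡⟨ cong (g i j *_) (δ-diagonal i j) ⟩
  g i j * 1ℤ                           ≡⟨ *-identityʳ (g i j) ⟩
  g i j                                ∎
  where
  off-row : ∀ a → ¬ a ≡ i → ∑≤ (N ∸ a) (λ b → g a b * δ i j a b) ≡ 0ℤ
  off-row a a≢i = ∑≤-zero (N ∸ a) (λ b _ → trans (cong (g a b *_) (δ-off-row b a≢i)) (*-zeroʳ (g a b)))
  off-column : ∀ b → ¬ b ≡ j → g i b * δ i j i b ≡ 0ℤ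
  off-column b b≢j = trans (cong (g i b *_) (δ-off-column b≢j)) (*-zeroʳ (g i b))

m∸n≡1+[m∸1+n] : ∀ {m n} → suc n ℕ.≤ m → m ∸ n ≡ suc (m ∸ suc n)
m∸n≡1+[m∸1+n] {suc m} (s≤s n≤m) = ℕ.+-∸-assoc 1 n≤m

weight : ℕ → ℕ → ℕ → ℤ
weight N a b = + (2 ^ (N ∸ (a ℕ.+ b)))

weight-split : ∀ {N} i j → suc (i ℕ.+ j) ℕ.≤ N →
               weight N i j ≡ weight N (suc i) j + weight N i (suc j)
weight-split {N} i j 1+i+j≤N = begin
  + (2 ^ (N ∸ (i ℕ.+ j)))      ≡⟨ cong (λ e → + (2 ^ e)) (m∸n≡1+[m∸1+n] 1+i+j≤N) ⟩
  + (2 ^ suc k)                ≡⟨ cong (λ x → + (2 ^ k ℕ.+ x)) (ℕ.+-identityʳ (2 ^ k)) ⟩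
  + (2 ^ k) + + (2 ^ k)        ≡⟨ cong (λ e → + (2 ^ k) + + (2 ^ (N ∸ e))) (sym (ℕ.+-suc i j)) ⟩
  weight N (suc i) j + weight N i (suc j) ∎
  where k = N ∸ suc (i ℕ.+ j)

weightedSum : ℕ → Config → ℤ
weightedSum N w = ∑△ N (λ a b → weight N a b * w a b)

module _ (N : ℕ) where

  weightedSum-cong : ∀ {w v : Config} → (∀ a b → w a b ≡ v a b) → weightedSum N w ≡ weightedSum N v
  weightedSum-cong w≗v = ∑△-cong N (λ a b → cong (weight N a b *_) (w≗v a b))

  weightedSum-zero : weightedSum N zeroConfig ≡ 0ℤ
  weightedSum-zero = ∑△-zero N (λ a b → *-zeroʳ (weight N a b))

  weightedSum-+ : ∀ (w v : Config) → weightedSum N (λ a b → w a b + v a b) ≡ weightedSum N w + weightedSum N v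
  weightedSum-+ w v = trans
    (∑△-cong N (λ a b → *-distribˡ-+ (weight N a b) (w a b) (v a b)))
    (∑△-distrib-+ N _ _)

  weightedSum-neg : ∀ (w : Config) → weightedSum N (λ a b → - w a b) ≡ - weightedSum N w
  weightedSum-neg w = trans
    (∑△-cong N (λ a b → sym (neg-distribʳ-* (weight N a b) (w a b))))
    (∑△-neg N _)

  module _ {i j} (i+j≤N : i ℕ.+ j ℕ.≤ N) (w : Config) where

    weightedSum-add-δ : weightedSum N (λ a b → w a b + δ i j a b) ≡ weightedSum N w + weight N i j
    weightedSum-add-δ = trans (weightedSum-+ w (δ i j))
      (cong (_+_ (weightedSum N w)) (∑△-*δ N (weight N) i+j≤N))

    weightedSum-sub-δ : weightedSum N (λ a b → w a b - δ i j a b) ≡ weightedSum N w - weight N i j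
    weightedSum-sub-δ = trans (weightedSum-+ w (λ a b → - δ i j a b))
      (cong (_+_ (weightedSum N w)) (trans (weightedSum-neg (δ i j)) (cong -_ (∑△-*δ N (weight N) i+j≤N))))

split-unsplit : ∀ i j w a b → split i j (unsplit i j w) a b ≡ w a b
split-unsplit i j w a b = cancel (w a b) (δ i j a b) (δ (suc i) j a b) (δ i (suc j) a b)
  where
  cancel : ∀ x p q r → x + p - q - r - p + q + r ≡ x
  cancel = solve-∀

module _ {N i j} (legal : suc (i ℕ.+ j) ℕ.≤ N) where

  weightedSum-split : ∀ w → weightedSum N (split i j w) ≡ weightedSum N w
  weightedSum-split w = begin
    weightedSum N (split i j w)
      ≡⟨ weightedSum-add-δ N (subst (ℕ._≤ N) (sym (ℕ.+-suc i j)) legal) _ ⟩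
    weightedSum N (λ a b → w a b - δ i j a b + δ (suc i) j a b) + weight N i (suc j)
      ≡⟨ cong (_+ weight N i (suc j)) (weightedSum-add-δ N legal _) ⟩
    weightedSum N (λ a b → w a b - δ i j a b) + weight N (suc i) j + weight N i (suc j)
      ≡⟨ cong (λ s → s + weight N (suc i) j + weight N i (suc j)) (weightedSum-sub-δ N (ℕ.<⇒≤ legal) w) ⟩
    weightedSum N w - weight N i j + weight N (suc i) j + weight N i (suc j)
      ≡⟨ cong (λ x → weightedSum N w - x + weight N (suc i) j + weight N i (suc j)) (weight-split i j legal) ⟩
    weightedSum N w - (weight N (suc i) j + weight N i (suc j)) + weight N (suc i) j + weight N i (suc j)
      ≡⟨ cancel (weightedSum N w) (weight N (suc i) j) (weight N i (suc j)) ⟩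
    weightedSum N w ∎
    where
    cancel : ∀ s x y → s - (x + y) + x + y ≡ s
    cancel = solve-∀

  weightedSum-unsplit : ∀ w → weightedSum N (unsplit i j w) ≡ weightedSum N w
  weightedSum-unsplit w = begin
    weightedSum N (unsplit i j w)              ≡⟨ weightedSum-split (unsplit i j w) ⟨
    weightedSum N (split i j (unsplit i j w))  ≡⟨ weightedSum-cong N (split-unsplit i j w) ⟩
    weightedSum N w                            ∎

weightedSum-applyMove : ∀ {N} m → LegalMove (fin N) m →
                        ∀ w → weightedSum N (applyMove m w) ≡ weightedSum N w
weightedSum-applyMove (move splitK   _ _) = weightedSum-split
weightedSum-applyMove (move unsplitK _ _) = weightedSum-unsplit

weightedSum-run : ∀ {N} ms → All (LegalMove (fin N)) ms → weightedSum N (run ms) ≡ 0ℤ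
weightedSum-run {N} []       []             = weightedSum-zero N
weightedSum-run     (m ∷ ms) (legal ∷ legals) =
  trans (weightedSum-applyMove m legal (run ms)) (weightedSum-run ms legals)

0≤+n*i : ∀ n {i} → 0ℤ ≤ i → 0ℤ ≤ + n * i
0≤+n*i n {+ m} _ = subst (0ℤ ≤_) (pos-* n m) (+≤+ z≤n)

weight*i≡0⇒i≡0 : ∀ N a b {i} → weight N a b * i ≡ 0ℤ → i ≡ 0ℤ
weight*i≡0⇒i≡0 N a b {i} eq = *-cancelˡ-≡ (weight N a b) i 0ℤ {{ℕ.m^n≢0 2 (N ∸ (a ℕ.+ b))}}
  (trans eq (sym (*-zeroʳ (weight N a b))))

weightedSum-nonneg-≡0 : ∀ N {w : Config} → (∀ a b → a ℕ.+ b ℕ.≤ N → 0ℤ ≤ w a b) →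
                        weightedSum N w ≡ 0ℤ →
                        ∀ a b → a ℕ.+ b ℕ.≤ N → w a b ≡ 0ℤ
weightedSum-nonneg-≡0 N w≥0 ∑≡0 a b a+b≤N = weight*i≡0⇒i≡0 N a b
  (∑△-nonneg-≡0 N (λ a b a+b≤N → 0≤+n*i (2 ^ (N ∸ (a ℕ.+ b))) (w≥0 a b a+b≤N)) ∑≡0 a b a+b≤N)

moveBound : List Move → ℕ
moveBound []       = 0
moveBound (m ∷ ms) = suc (pi m ℕ.+ pj m) ⊔ moveBound ms

legal-within-moveBound : ∀ {N} ms → moveBound ms ℕ.≤ N → All (LegalMove (fin N)) ms
legal-within-moveBound []       _   = []
legal-within-moveBound (m ∷ ms) m≤N =
  ℕ.≤-trans (ℕ.m≤m⊔n _ (moveBound ms)) m≤N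
    ∷ legal-within-moveBound ms (ℕ.≤-trans (ℕ.m≤n⊔m _ (moveBound ms)) m≤N)

lemma3p21 : (d : ℕ∞) (ms : List Move) → All (LegalMove d) ms →
    (∀ i j → InV d i j → 0ℤ ≤ run ms i j) →
    ∀ i j → InV d i j → run ms i j ≡ 0ℤ
lemma3p21 (fin N) ms legal nonneg = weightedSum-nonneg-≡0 N nonneg (weightedSum-run ms legal)
lemma3p21 ∞       ms _     nonneg i j _ =
  weightedSum-nonneg-≡0 N (λ a b _ → nonneg a b tt)
    (weightedSum-run ms (legal-within-moveBound ms (ℕ.m≤m⊔n _ _))) i j (ℕ.m≤n⊔m _ _)
  where
  N = moveBound ms ⊔ (i ℕ.+ j)
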